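{- Let $\mathcal C=\langle\Omega,\{\mathcal E_C,\mathcal E_A,\mathcal E_R\},f\rangle$ be a generalized choice structure, and write $\mathcal E=\mathcal E_C\cup\mathcal E_A\cup\mathcal E_R$. Then the following are equivalent: (A) $\mathcal C$ is basic-AGM consistent. (B) For every $E\in\mathcal E$: (1) if $E\cap f(\Omega)\neq\varnothing$ then (a) if $E\in\mathcal E_C$ then $f(E)=E\cap f(\Omega)$, and (b) if $E\in\mathcal E_A$ then $f(E)=f(\Omega)$; (2) if $E\cap f(\Omega)=\varnothing$ and $E\in\mathcal E_A$ then $f(E)=f(\Omega)\cup E'$ for some nonempty $E'\subseteq E$.
   Context: A generalized choice structure (GCS) is a tuple $\langle\Omega,\{\mathcal E_C,\mathcal E_A,\mathcal E_R\},f\rangle$ where $\Omega\neq\varnothing$; $\mathcal E_C,\mathcal E_A,\mathcal E_R$ are mutually disjoint subsets of $2^\Omega$ with $\Omega\in\mathcal E_C$ and $\varnothing\in\mathcal E_R$ (their union $\mathcal E$ need not be all of $2^\Omega$); and $f:\mathcal E\to2^\Omega$ satisfies: $f(\Omega)\neq\varnothing$; if $E\in\mathcal E_R$ then $f(E)=f(\Omega)$; if $E\in\mathcal E_C$ then $\varnothing\neq f(E)\subseteq E$; if $E\in\mathcal E_A$ then $f(E)\cap E\neq\varnothing$. Syntax: $\Phi$ is the set of formulas of a propositional language over a countable set $A$ of atoms with $\neg,\vee$. For $S\subseteq\Phi$, $[S]^{PL}$ is the set of $\psi$ such that $(\phi_1\wedge\cdots\wedge\phi_n)\to\psi$ is a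 tautology for some $\phi_1,\dots,\phi_n\in S$ ($n\ge0$); $S$ is consistent if $[S]^{PL}\ne\Phi$ and deductively closed if $S=[S]^{PL}$. A credibility partition is a partition of $\Phi$ into $\Phi_C,\Phi_A,\Phi_R$ where $\Phi_C$ contains all tautologies, consists of consistent formulas and is closed under logical equivalence; $\Phi_A$ (possibly empty) consists of consistent formulas and is closed under logical equivalence; $\Phi_R$ contains all contradictions. A valuation is $V:A\to2^\Omega$; truth at states is defined as usual ($\omega\models p$ iff $\omega\in V(p)$, $\omega\models\neg\phi$ iff not $\omega\models\phi$, $\omega\models\phi\vee\psi$ iff $\omega\models\phi$ or $\omega\models\psi$), and $\|\phi\|=\{\omega:\omega\models\phi\}$. A model of the GCS is obtained by adding a credibility partition $\{\Phi_C,\Phi_A,\Phi_R\}$ and a valuation $V$ such that for all $\phi$: $\|\phi\|\in\mathcal E_C\Rightarrow\phi\in\Phi_C$, $\|\phi\|\in\mathcal E_A\Rightarrow\phi\in\Phi_A$, $\|\phi\|\in\mathcal E_R\Rightarrow\phi\in\Phi_R$. Given a model, set $K=\{\phi:f(\Omega)\subseteq\|\phi\|\}$, $\Psi=\{\phi:\|\phi\|\in\mathcal E\}$, and $B_{K,\Psi}:\Psi\to2^\Phi$, $B_{K,\Psi}(\phi)=\{\psi:f(\|\phi\|)\subseteq\|\psi\|\}$. A basic AGM belief revision function based on $K$ is $B^\ast_K:\Phi\to2^\Phi$ with, for all $\phi,\psi$: $B^\ast_K(\phi)=[B^\ast_K(\phi)]^{PL}$; $\phi\in B^\ast_K(\phi)$;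 $B^\ast_K(\phi)\subseteq[K\cup\{\phi\}]^{PL}$; if $\neg\phi\notin K$ then $[K\cup\{\phi\}]^{PL}\subseteq B^\ast_K(\phi)$; $B^\ast_K(\phi)=\Phi$ iff $\phi$ is a contradiction; if $\phi\leftrightarrow\psi$ is a tautology then $B^\ast_K(\phi)=B^\ast_K(\psi)$. The GCS is basic-AGM consistent if for every model there exist a function $B^\circ_K:\Phi\to2^\Phi$ with $B^\circ_K(\phi)=B_{K,\Psi}(\phi)$ for all $\phi\in\Psi$, and a basic AGM belief revision function $B^\ast_K$, such that for all $\phi\in\Phi$: $B^\circ_K(\phi)=K$ if $\phi\in\Phi_R$, $B^\circ_K(\phi)=B^\ast_K(\phi)$ if $\phi\in\Phi_C$, and $B^\circ_K(\phi)=K\cap B^\ast_K(\phi)$ if $\phi\in\Phi_A$. -}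

module Defs where

open import Level using (0ℓ)
open import Data.Nat using (ℕ)
open import Data.Bool using (Bool; true; false; not; _∨_)
open import Data.List using (List; []; _∷_)
open import Data.List.Relation.Unary.All using (All)
open import Data.Product using (Σ; ∃; ∃-syntax; _×_; _,_)
open import Data.Sum using (_⊎_)
open import Data.Empty using (⊥)
open import Data.Unit using (⊤)
open import Relation.Nullary using (¬_)
open import Relation.Binary.PropositionalEquality using (_≡_)
open import Function.Bundles using (_⇔_)

Subset : Set → Set₁
Subset X = X → Set

_⊆_ : {X : Set} → Subset X → Subset X → Set
S ⊆ T = ∀ x → S x → T x

_≐_ : {X : Set} → Subset X → Subset X → Set
S ≐ T = (S ⊆ T) × (T ⊆ S)

_∩_ : {X : Set} → Subset X → Subset X → Subset X
(S ∩ T) x = S x × T x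

_∪_ : {X : Set} → Subset X → Subset X → Subset X
(S ∪ T) x = S x ⊎ T x

Full : {X : Set} → Subset X
Full _ = ⊤

Empty : {X : Set} → Subset X
Empty _ = ⊥

Inhabited : {X : Set} → Subset X → Set
Inhabited S = ∃ λ x → S x

IsEmpty : {X : Set} → Subset X → Set
IsEmpty S = ∀ x → ¬ S x

Family : Set → Set₁
Family X = Subset X → Set

record GCS (Ω : Set) : Set₁ where
  field
    Ω-nonempty : ¬ (Ω → ⊥)
    𝓔C 𝓔A 𝓔R : Family Ω
    -- families are sets of subsets: membership respects set equality
    𝓔C-resp : ∀ E E′ → E ≐ E′ → 𝓔C E → 𝓔C E′
    𝓔A-resp : ∀ E E′ → E ≐ E′ → 𝓔A E → 𝓔A E′
    𝓔R-resp : ∀ E E′ → E ≐ E′ → 𝓔R E → 𝓔R E′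
    disjCA : ∀ E → 𝓔C E → 𝓔A E → ⊥
    disjCR : ∀ E → 𝓔C E → 𝓔R E → ⊥
    disjAR : ∀ E → 𝓔A E → 𝓔R E → ⊥
    Ω∈𝓔C : 𝓔C Full
    ∅∈𝓔R : 𝓔R Empty
    -- the choice function (only its values on 𝓔 matter)
    f : Subset Ω → Subset Ω
    f-resp : ∀ E E′ → E ≐ E′ → f E ≐ f E′
    fΩ-nonempty : Inhabited (f Full)
    f-R : ∀ E → 𝓔R E → f E ≐ f Full
    f-C : ∀ E → 𝓔C E → Inhabited (f E) × (f E ⊆ E)
    f-A : ∀ E → 𝓔A E → Inhabited (f E ∩ E)

  𝓔 : Family Ω
  𝓔 E = 𝓔C E ⊎ 𝓔A E ⊎ 𝓔R E

data Formula : Set where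
  atom : ℕ → Formula
  ¬′_  : Formula → Formula
  _∨′_ : Formula → Formula → Formula

infix  30 ¬′_
infixr 20 _∨′_
infixr 25 _∧′_
infixr 15 _⇒′_ _⇔′_

_∧′_ : Formula → Formula → Formula
φ ∧′ ψ = ¬′ (¬′ φ ∨′ ¬′ ψ)

_⇒′_ : Formula → Formula → Formula
φ ⇒′ ψ = ¬′ φ ∨′ ψ

_⇔′_ : Formula → Formula → Formula
φ ⇔′ ψ = (φ ⇒′ ψ) ∧′ (ψ ⇒′ φ)

⊤′ : Formula
⊤′ = atom 0 ∨′ ¬′ atom 0

⋀ : List Formula → Formula
⋀ []       = ⊤′
⋀ (φ ∷ []) = φ
⋀ (φ ∷ φs) = φ ∧′ ⋀ φs

eval : (ℕ → Bool) → Formula → Bool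
eval v (atom n) = v n
eval v (¬′ φ)   = not (eval v φ)
eval v (φ ∨′ ψ) = eval v φ ∨ eval v ψ

Tautology : Formula → Set
Tautology φ = ∀ (v : ℕ → Bool) → eval v φ ≡ true

Contradiction : Formula → Set
Contradiction φ = ∀ (v : ℕ → Bool) → eval v φ ≡ false

FSet : Set₁
FSet = Subset Formula

Φ : FSet
Φ = Full

Cn : FSet → FSet
Cn S ψ = Σ (List Formula) λ φs → All S φs × Tautology (⋀ φs ⇒′ ψ)

Consistent : FSet → Set
Consistent S = ¬ (Cn S ≐ Φ)

DeductivelyClosed : FSet → Set
DeductivelyClosed S = S ≐ Cn S

singleton : Formula → FSet
singleton φ ψ = φ ≡ ψ

ConsistentFormula : Formula → Set
ConsistentFormula φ = Consistent (singleton φ)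

ClosedUnderEquiv : FSet → Set
ClosedUnderEquiv S = ∀ φ ψ → Tautology (φ ⇔′ ψ) → S φ → S ψ

record CredibilityPartition (ΦC ΦA ΦR : FSet) : Set where
  field
    cover  : ∀ φ → ΦC φ ⊎ ΦA φ ⊎ ΦR φ
    disjCA : ∀ φ → ΦC φ → ΦA φ → ⊥
    disjCR : ∀ φ → ΦC φ → ΦR φ → ⊥
    disjAR : ∀ φ → ΦA φ → ΦR φ → ⊥
    C-taut    : ∀ φ → Tautology φ → ΦC φ
    C-cons    : ∀ φ → ΦC φ → ConsistentFormula φ
    C-equiv   : ClosedUnderEquiv ΦC
    A-cons    : ∀ φ → ΦA φ → ConsistentFormula φ
    A-equiv   : ClosedUnderEquiv ΦA
    R-contra  : ∀ φ → Contradiction φ → ΦR φ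

Valuation : Set → Set₁
Valuation Ω = ℕ → Subset Ω

_⊨_ : {Ω : Set} → (V : Valuation Ω) → Formula → Subset Ω
(V ⊨ (atom n)) ω = V n ω
(V ⊨ (¬′ φ)) ω = ¬ (V ⊨ φ) ω
(V ⊨ (φ ∨′ ψ)) ω = (V ⊨ φ) ω ⊎ (V ⊨ ψ) ω

⟦_⟧ : {Ω : Set} → Formula → Valuation Ω → Subset Ω
⟦ φ ⟧ V = V ⊨ φ

record Model {Ω : Set} (𝒞 : GCS Ω) : Set₁ where
  open GCS 𝒞
  field
    ΦC ΦA ΦR : FSet
    partition : CredibilityPartition ΦC ΦA ΦR
    V : Valuation Ω
    compatC : ∀ φ → 𝓔C (⟦ φ ⟧ V) → ΦC φ
    compatA : ∀ φ → 𝓔A (⟦ φ ⟧ V) → ΦA φ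
    compatR : ∀ φ → 𝓔R (⟦ φ ⟧ V) → ΦR φ

  K : FSet
  K φ = f Full ⊆ ⟦ φ ⟧ V

  Ψ : FSet
  Ψ φ = 𝓔 (⟦ φ ⟧ V)

  -- B_{K,Ψ}, meaningful for φ ∈ Ψ
  BKΨ : Formula → FSet
  BKΨ φ ψ = f (⟦ φ ⟧ V) ⊆ ⟦ ψ ⟧ V

_+′_ : FSet → Formula → FSet
(K +′ φ) ψ = K ψ ⊎ φ ≡ ψ

record IsBasicAGM (K : FSet) (B : Formula → FSet) : Set₁ where
  field
    closure   : ∀ φ → B φ ≐ Cn (B φ)
    success   : ∀ φ → B φ φ
    inclusion : ∀ φ → B φ ⊆ Cn (K +′ φ)
    vacuity   : ∀ φ → ¬ K (¬′ φ) → Cn (K +′ φ) ⊆ B φ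
    consistency : ∀ φ → (B φ ≐ Φ) ⇔ Contradiction φ
    extensionality : ∀ φ ψ → Tautology (φ ⇔′ ψ) → B φ ≐ B ψ

BasicAGMConsistent : {Ω : Set} → GCS Ω → Set₁
BasicAGMConsistent 𝒞 =
  (M : Model 𝒞) → let open Model M in
  Σ (Formula → FSet) λ B° →
    (∀ φ → Ψ φ → B° φ ≐ BKΨ φ) ×
    Σ (Formula → FSet) λ B* →
      IsBasicAGM K B* ×
      (∀ φ → (ΦR φ → B° φ ≐ K)
           × (ΦC φ → B° φ ≐ B* φ)
           × (ΦA φ → B° φ ≐ (K ∩ B* φ)))

ConditionB : {Ω : Set} → GCS Ω → Set₁
ConditionB {Ω} 𝒞 = let open GCS 𝒞 in
  ∀ E → 𝓔 E →
    (Inhabited (E ∩ f Full) →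
        (𝓔C E → f E ≐ (E ∩ f Full))
      × (𝓔A E → f E ≐ f Full))
  × (IsEmpty (E ∩ f Full) → 𝓔A E →
        Σ (Subset Ω) λ E′ → (E′ ⊆ E) × Inhabited E′ × (f E ≐ (f Full ∪ E′)))

module Submission where

-- The proof works with the theory  Th V X = {ψ | X ⊆ ‖ψ‖}  of a set of states X.
-- Classically, Th V X is deductively closed, it is inconsistent iff X = ∅,
-- and the AGM expansion  [Th V X ∪ {φ}]^PL  is  Th V (‖φ‖ ∩ X).
--
-- (A) ⇒ (B).  Every valuation extends to a model of 𝒞 (the canonical model,
--   whose credibility classes are read off from 𝓔C, 𝓔A, 𝓔R).  For E ∈ 𝓔 we
--   use a valuation whose atoms name E, f Ω, f E and E ∩ f Ω; comparing
--   B_{K,Ψ}(p₀) = Th (f E) with K, with B*(p₀) = Th (E ∩ f Ω) (when E meets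
--   f Ω) or with K ∩ B*(p₀), on these atoms yields the equations of (B).
--
-- (B) ⇒ (A).  Given a model, B*(φ) is the theory of f‖φ‖ ∩ ‖φ‖ if ‖φ‖ ∈ 𝓔C ∪ 𝓔A,
--   else of ‖φ‖ ∩ f Ω if that is nonempty, else of the Boolean models of φ.
--   (B) makes the first two choices agree whenever both apply, which is what
--   the AGM postulates need; B°(φ) is prescribed by the credibility class of φ,
--   and (B) also gives f E = f Ω ∪ (f E ∩ E) for E ∈ 𝓔A, so B° agrees with B_{K,Ψ}.

open import Defs
open import Level using (0ℓ; lift; lower)
import Level
open import Axiom.ExcludedMiddle using (ExcludedMiddle)
open import Function using (_∘_; id)
open import Function.Bundles using (_⇔_; mk⇔; Equivalence)
import Function.Properties.Equivalence as ⇔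
open import Function.Related.TypeIsomorphisms using (¬-cong-⇔)
open import Data.Sum.Function.Propositional using (_⊎-⇔_)
open import Data.Nat using (ℕ)
open import Data.Bool using (Bool; true; false; not; _∨_)
open import Data.List using (List; []; _∷_)
open import Data.List.Relation.Unary.All using (All; []; _∷_)
import Data.List.Relation.Unary.All as All
open import Data.Product using (_×_; _,_; proj₁; proj₂)
open import Data.Sum using (_⊎_; inj₁; inj₂; [_,_]′; map₂)
open import Data.Empty using (⊥; ⊥-elim)
open import Data.Unit using (tt)
open import Relation.Nullary using (¬_; Dec; yes; no; does)
open import Relation.Nullary.Decidable using (map′)
open import Relation.Binary.PropositionalEquality using (_≡_; refl; sym; trans)
open import Relation.Binary.Bundles using (Setoid)
import Relation.Binary.Reasoning.Setoid as SetoidReasoning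

open Equivalence using (to; from)

≐-refl : {X : Set} {S : Subset X} → S ≐ S
≐-refl = (λ _ s → s) , (λ _ s → s)

≐-sym : {X : Set} {S T : Subset X} → S ≐ T → T ≐ S
≐-sym (S⊆T , T⊆S) = T⊆S , S⊆T

≐-trans : {X : Set} {S T U : Subset X} → S ≐ T → T ≐ U → S ≐ U
≐-trans (S⊆T , T⊆S) (T⊆U , U⊆T) = (λ x → T⊆U x ∘ S⊆T x) , (λ x → T⊆S x ∘ U⊆T x)

≐-setoid : Set → Setoid (Level.suc 0ℓ) 0ℓ
≐-setoid X = record
  { Carrier = Subset X
  ; _≈_ = _≐_
  ; isEquivalence = record { refl = ≐-refl ; sym = ≐-sym ; trans = ≐-trans }
  }

module ≐-Reasoning {X : Set} = SetoidReasoning (≐-setoid X)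

∩-cong : {X : Set} {S S′ T T′ : Subset X} → S ≐ S′ → T ≐ T′ → (S ∩ T) ≐ (S′ ∩ T′)
∩-cong (S⊆ , ⊆S) (T⊆ , ⊆T) =
  (λ x (s , t) → S⊆ x s , T⊆ x t) , (λ x (s , t) → ⊆S x s , ⊆T x t)

∩-comm : {X : Set} {S T : Subset X} → (S ∩ T) ≐ (T ∩ S)
∩-comm = (λ _ (s , t) → t , s) , (λ _ (t , s) → s , t)

meets-resp : {X : Set} {S S′ T : Subset X} → S ≐ S′ → Inhabited (S ∩ T) → Inhabited (S′ ∩ T)
meets-resp (S⊆S′ , _) (x , s , t) = x , S⊆S′ x s , t

∩-absorb : {X : Set} {S T : Subset X} → S ⊆ T → (S ∩ T) ≐ S
∩-absorb S⊆T = (λ _ → proj₁) , (λ x s → s , S⊆T x s)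

-- If P ⊆ F ⊆ P ∪ E, then F consists of P together with the part of F inside E.
-- This is the shape of f E for E ∈ 𝓔A, with P = f Ω and F = f E.
split-by : {X : Set} {E F P : Subset X} → P ⊆ F → F ⊆ (P ∪ E) → F ≐ (P ∪ (F ∩ E))
split-by {E = E} {F} {P} P⊆F F⊆P∪E = F⊆ , ⊆F
  where
  F⊆ : F ⊆ (P ∪ (F ∩ E))
  F⊆ x y with F⊆P∪E x y
  ... | inj₁ p = inj₁ p
  ... | inj₂ e = inj₂ (y , e)
  ⊆F : (P ∪ (F ∩ E)) ⊆ F
  ⊆F x (inj₁ p) = P⊆F x p
  ⊆F x (inj₂ (y , _)) = y

_⊩_ : (ℕ → Bool) → Formula → Set
v ⊩ φ = eval v φ ≡ true

not-true : ∀ b → (not b ≡ true) ⇔ (¬ b ≡ true)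
not-true true  = mk⇔ (λ ()) (λ b≢true → ⊥-elim (b≢true refl))
not-true false = mk⇔ (λ _ ()) (λ _ → refl)

∨-true : ∀ a b → (a ∨ b ≡ true) ⇔ (a ≡ true ⊎ b ≡ true)
∨-true true  _ = mk⇔ (λ _ → inj₁ refl) (λ _ → refl)
∨-true false _ = mk⇔ inj₂ [ (λ ()) , id ]′

∧-true : ∀ a b → (not (not a ∨ not b) ≡ true) ⇔ (a ≡ true × b ≡ true)
∧-true true  true  = mk⇔ (λ _ → refl , refl) (λ _ → refl)
∧-true true  false = mk⇔ (λ ()) (λ { (_ , ()) })
∧-true false _     = mk⇔ (λ ()) (λ { (() , _) })

⇒-true : ∀ a b → (not a ∨ b ≡ true) ⇔ (a ≡ true → b ≡ true)
⇒-true true  _ = mk⇔ (λ b _ → b) (λ a→b → a→b refl)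
⇒-true false _ = mk⇔ (λ _ ()) (λ _ → refl)

⊩-⇒ : ∀ v φ ψ → v ⊩ (φ ⇒′ ψ) ⇔ (v ⊩ φ → v ⊩ ψ)
⊩-⇒ v φ ψ = ⇒-true (eval v φ) (eval v ψ)

⊩-⇔ : ∀ v φ ψ → v ⊩ (φ ⇔′ ψ) → v ⊩ φ ⇔ v ⊩ ψ
⊩-⇔ v φ ψ φ⇔ψ = mk⇔ (to (⊩-⇒ v φ ψ) φ⇒ψ) (to (⊩-⇒ v ψ φ) ψ⇒φ)
  where
  φ⇒ψ : v ⊩ (φ ⇒′ ψ)
  φ⇒ψ = proj₁ (to (∧-true (eval v (φ ⇒′ ψ)) (eval v (ψ ⇒′ φ))) φ⇔ψ)
  ψ⇒φ : v ⊩ (ψ ⇒′ φ)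
  ψ⇒φ = proj₂ (to (∧-true (eval v (φ ⇒′ ψ)) (eval v (ψ ⇒′ φ))) φ⇔ψ)

⊩-⊤ : ∀ v → v ⊩ ⊤′
⊩-⊤ v with v 0
... | true  = refl
... | false = refl

⊩-⋀ : ∀ v φs → v ⊩ ⋀ φs ⇔ All (v ⊩_) φs
⊩-⋀ v []            = mk⇔ (λ _ → []) (λ _ → ⊩-⊤ v)
⊩-⋀ v (φ ∷ [])      = mk⇔ (_∷ []) All.head
⊩-⋀ v (φ ∷ φ′ ∷ φs) = ⇔.trans (∧-true (eval v φ) (eval v (⋀ (φ′ ∷ φs))))
  (mk⇔ (λ (h , hs) → h ∷ to (⊩-⋀ v (φ′ ∷ φs)) hs)
       (λ hs → All.head hs , from (⊩-⋀ v (φ′ ∷ φs)) (All.tail hs)))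

Cn-intro : {S : FSet} (ψ : Formula) (φs : List Formula) → All S φs
  → (∀ v → All (v ⊩_) φs → v ⊩ ψ) → Cn S ψ
Cn-intro ψ φs Sφs entails =
  φs , Sφs , λ v → from (⊩-⇒ v (⋀ φs) ψ) (entails v ∘ to (⊩-⋀ v φs))

Cn-mono : {S S′ : FSet} → S ⊆ S′ → Cn S ⊆ Cn S′
Cn-mono S⊆S′ ψ (φs , Sφs , taut) = φs , All.map (λ {χ} → S⊆S′ χ) Sφs , taut

Cn-inflationary : {S : FSet} → S ⊆ Cn S
Cn-inflationary ψ Sψ = Cn-intro ψ (ψ ∷ []) (Sψ ∷ []) (λ _ → All.head)

semantics-agree : {Ω : Set} {V : Valuation Ω} {ω : Ω} {v : ℕ → Bool}
  → (∀ n → V n ω ⇔ (v n ≡ true)) → ∀ φ → (V ⊨ φ) ω ⇔ v ⊩ φ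
semantics-agree atoms (atom n) = atoms n
semantics-agree {v = v} atoms (¬′ φ) =
  ⇔.trans (¬-cong-⇔ (semantics-agree atoms φ)) (⇔.sym (not-true (eval v φ)))
semantics-agree {v = v} atoms (φ ∨′ ψ) =
  ⇔.trans (semantics-agree atoms φ ⊎-⇔ semantics-agree atoms ψ)
          (⇔.sym (∨-true (eval v φ) (eval v ψ)))

Assignments : Valuation (ℕ → Bool)
Assignments n v = v n ≡ true

⊨-Assignments : ∀ φ v → (Assignments ⊨ φ) v ⇔ v ⊩ φ
⊨-Assignments φ v = semantics-agree (λ _ → ⇔.refl) φ

contradiction-if-unsatisfiable : ∀ φ → IsEmpty (⟦ φ ⟧ Assignments) → Contradiction φ
contradiction-if-unsatisfiable φ unsat v with eval v φ in eq
... | true  = ⊥-elim (unsat v (from (⊨-Assignments φ v) eq))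
... | false = refl

Th : {Ω : Set} → Valuation Ω → Subset Ω → FSet
Th V X ψ = X ⊆ ⟦ ψ ⟧ V

Th-resp : {Ω : Set} {V : Valuation Ω} {X Y : Subset Ω} → X ≐ Y → Th V X ≐ Th V Y
Th-resp (X⊆Y , Y⊆X) = (λ ψ X⊨ψ ω → X⊨ψ ω ∘ Y⊆X ω) , (λ ψ Y⊨ψ ω → Y⊨ψ ω ∘ X⊆Y ω)

Th-antitone : {Ω : Set} {V : Valuation Ω} {X Y : Subset Ω} → X ⊆ Y → Th V Y ⊆ Th V X
Th-antitone X⊆Y ψ Y⊨ψ ω = Y⊨ψ ω ∘ X⊆Y ω

Th-∪ : {Ω : Set} {V : Valuation Ω} {X Y : Subset Ω} → (Th V X ∩ Th V Y) ≐ Th V (X ∪ Y)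
Th-∪ = (λ ψ (X⊨ψ , Y⊨ψ) ω → [ X⊨ψ ω , Y⊨ψ ω ]′)
     , (λ ψ X∪Y⊨ψ → (λ ω → X∪Y⊨ψ ω ∘ inj₁) , (λ ω → X∪Y⊨ψ ω ∘ inj₂))

atom-sets-determined : {Ω : Set} {V : Valuation Ω} (m n : ℕ)
  → Th V (V m) ≐ Th V (V n) → V m ≐ V n
atom-sets-determined m n (m⊆n , n⊆m) = n⊆m (atom n) (λ _ → id) , m⊆n (atom m) (λ _ → id)

-- A theory of states is inconsistent exactly when there are no states;
-- no classical reasoning is needed since ¬′ ⊤′ is refutable at every state.
Th-trivial : {Ω : Set} {V : Valuation Ω} {X : Subset Ω} → (Th V X ≐ Φ) ⇔ IsEmpty X
Th-trivial = mk⇔ (λ (_ , everything) ω x → refute (everything (¬′ ⊤′) tt ω x))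
                 (λ empty → (λ _ _ → tt) , (λ ψ _ ω x → ⊥-elim (empty ω x)))
  where
  refute : {P : Set} → ¬ ¬ (P ⊎ ¬ P)
  refute ¬lem = ¬lem (inj₂ (¬lem ∘ inj₁))

-- Revision functions built from such sets
-- satisfy closure, success and consistency (see Classical below).
record TheoryOfStates (B : FSet) (φ : Formula) : Set₁ where
  field
    {States} : Set
    U : Valuation States
    R : Subset States
    R⊨φ : R ⊆ ⟦ φ ⟧ U
    nonempty : IsEmpty R → Contradiction φ
    B≐Th : B ≐ Th U R

module Classical (lem : ExcludedMiddle 0ℓ) where

  does-true : {P : Set} (d : Dec P) → P ⇔ (does d ≡ true)
  does-true (yes p) = mk⇔ (λ _ → refl) (λ _ → p)
  does-true (no ¬p) = mk⇔ (⊥-elim ∘ ¬p) (λ ())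

  atomsAt : {Ω : Set} → Valuation Ω → Ω → ℕ → Bool
  atomsAt V ω n = does (lem {V n ω})

  holds⇔ : {Ω : Set} {V : Valuation Ω} {ω : Ω} (φ : Formula) → (V ⊨ φ) ω ⇔ atomsAt V ω ⊩ φ
  holds⇔ = semantics-agree (λ _ → does-true lem)

  module _ {Ω : Set} {V : Valuation Ω} where

    tautology-holds : ∀ φ → Tautology φ → ∀ ω → (V ⊨ φ) ω
    tautology-holds φ taut ω = from (holds⇔ φ) (taut (atomsAt V ω))

    contradiction-empty : ∀ φ → Contradiction φ → IsEmpty (⟦ φ ⟧ V)
    contradiction-empty φ contra ω φ-holds
      with () ← trans (sym (to (holds⇔ φ) φ-holds)) (contra (atomsAt V ω))

    equivalent-extension : ∀ φ ψ → Tautology (φ ⇔′ ψ) → ⟦ φ ⟧ V ≐ ⟦ ψ ⟧ V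
    equivalent-extension φ ψ taut =
        (λ ω → from (holds⇔ ψ) ∘ to (same ω) ∘ to (holds⇔ φ))
      , (λ ω → from (holds⇔ φ) ∘ from (same ω) ∘ to (holds⇔ ψ))
      where
      same : ∀ ω → atomsAt V ω ⊩ φ ⇔ atomsAt V ω ⊩ ψ
      same ω = ⊩-⇔ (atomsAt V ω) φ ψ (taut (atomsAt V ω))

    Cn-sound : {S : FSet} {X : Subset Ω} → S ⊆ Th V X → Cn S ⊆ Th V X
    Cn-sound {S} S⊆ ψ (φs , Sφs , taut) ω x =
      from (holds⇔ ψ) (to (⊩-⇒ v (⋀ φs) ψ) (taut v) (from (⊩-⋀ v φs) premises-true))
      where
      v : ℕ → Bool
      v = atomsAt V ω
      premises-true : All (v ⊩_) φs
      premises-true = All.map (λ {χ} Sχ → to (holds⇔ χ) (S⊆ χ Sχ ω x)) Sφs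

    Th-closed : {X : Subset Ω} → DeductivelyClosed (Th V X)
    Th-closed = Cn-inflationary , Cn-sound (λ _ X⊨ψ → X⊨ψ)

    expansion : ∀ X φ → Cn (Th V X +′ φ) ≐ Th V (⟦ φ ⟧ V ∩ X)
    expansion X φ = Cn-sound expanded-sound
                  , λ ψ th → Cn-intro ψ ((φ ⇒′ ψ) ∷ φ ∷ []) (inj₁ (implication ψ th) ∷ inj₂ refl ∷ [])
                                      (λ v → λ { (φ⇒ψ ∷ φ-true ∷ []) → to (⊩-⇒ v φ ψ) φ⇒ψ φ-true })
      where
      expanded-sound : (Th V X +′ φ) ⊆ Th V (⟦ φ ⟧ V ∩ X)
      expanded-sound χ (inj₁ X⊨χ) ω (_ , x) = X⊨χ ω x
      expanded-sound χ (inj₂ refl) ω (φ-holds , _) = φ-holds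
      implication : ∀ ψ → Th V (⟦ φ ⟧ V ∩ X) ψ → Th V X (φ ⇒′ ψ)
      implication ψ th ω x with lem {(V ⊨ φ) ω}
      ... | yes φ-holds = inj₂ (th ω (φ-holds , x))
      ... | no ¬φ-holds = inj₁ ¬φ-holds

  satisfiable-consistent : {Ω : Set} (V : Valuation Ω) → ∀ φ → Inhabited (⟦ φ ⟧ V) → ConsistentFormula φ
  satisfiable-consistent V φ (ω , φ-holds) (_ , everything) =
    to Th-trivial ((λ _ _ → tt) , (λ ψ → Cn-sound φ-true ψ ∘ everything ψ)) ω φ-holds
    where
    φ-true : singleton φ ⊆ Th V (⟦ φ ⟧ V)
    φ-true χ refl _ χ-holds = χ-holds

  module _ {B : FSet} {φ : Formula} (T : TheoryOfStates B φ) where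
    open TheoryOfStates T

    theory-closed : B ≐ Cn B
    theory-closed = Cn-inflationary
                  , λ ψ → proj₂ B≐Th ψ ∘ proj₂ Th-closed ψ ∘ Cn-mono (proj₁ B≐Th) ψ

    theory-success : B φ
    theory-success = proj₂ B≐Th φ R⊨φ

    theory-consistency : (B ≐ Φ) ⇔ Contradiction φ
    theory-consistency = mk⇔
      (λ B-trivial → nonempty (to Th-trivial (≐-trans (≐-sym B≐Th) B-trivial)))
      (λ contra → ≐-trans B≐Th (from Th-trivial (λ ω r → contradiction-empty φ contra ω (R⊨φ ω r))))

module CanonicalModel (lem : ExcludedMiddle 0ℓ) {Ω : Set} (𝒞 : GCS Ω) (V : Valuation Ω) where
  open GCS 𝒞 hiding (disjCA; disjCR; disjAR)
  open Classical lem

  ‖_‖ : Formula → Subset Ω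
  ‖ φ ‖ = ⟦ φ ⟧ V

  Satisfiable : Formula → Set
  Satisfiable φ = Inhabited (⟦ φ ⟧ Assignments)

  ΦC ΦA ΦR : FSet
  ΦC φ = 𝓔C ‖ φ ‖ ⊎ (¬ 𝓔 ‖ φ ‖ × Satisfiable φ)
  ΦA φ = 𝓔A ‖ φ ‖
  ΦR φ = 𝓔R ‖ φ ‖ ⊎ (¬ 𝓔 ‖ φ ‖ × ¬ Satisfiable φ)

  𝓔-resp : ∀ E E′ → E ≐ E′ → 𝓔 E → 𝓔 E′
  𝓔-resp E E′ E≐E′ (inj₁ c)        = inj₁ (𝓔C-resp E E′ E≐E′ c)
  𝓔-resp E E′ E≐E′ (inj₂ (inj₁ a)) = inj₂ (inj₁ (𝓔A-resp E E′ E≐E′ a))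
  𝓔-resp E E′ E≐E′ (inj₂ (inj₂ r)) = inj₂ (inj₂ (𝓔R-resp E E′ E≐E′ r))

  cover : ∀ φ → ΦC φ ⊎ ΦA φ ⊎ ΦR φ
  cover φ with lem {𝓔 ‖ φ ‖} | lem {Satisfiable φ}
  ... | yes (inj₁ c)        | _       = inj₁ (inj₁ c)
  ... | yes (inj₂ (inj₁ a)) | _       = inj₂ (inj₁ a)
  ... | yes (inj₂ (inj₂ r)) | _       = inj₂ (inj₂ (inj₁ r))
  ... | no out              | yes sat = inj₁ (inj₂ (out , sat))
  ... | no out              | no unsat = inj₂ (inj₂ (inj₂ (out , unsat)))

  disjCA : ∀ φ → ΦC φ → ΦA φ → ⊥
  disjCA φ (inj₁ c) a         = GCS.disjCA 𝒞 _ c a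
  disjCA φ (inj₂ (out , _)) a = out (inj₂ (inj₁ a))

  disjCR : ∀ φ → ΦC φ → ΦR φ → ⊥
  disjCR φ (inj₁ c)           (inj₁ r)           = GCS.disjCR 𝒞 _ c r
  disjCR φ (inj₁ c)           (inj₂ (out , _))   = out (inj₁ c)
  disjCR φ (inj₂ (out , _))   (inj₁ r)           = out (inj₂ (inj₂ r))
  disjCR φ (inj₂ (_ , sat))   (inj₂ (_ , unsat)) = unsat sat

  disjAR : ∀ φ → ΦA φ → ΦR φ → ⊥
  disjAR φ a (inj₁ r)         = GCS.disjAR 𝒞 _ a r
  disjAR φ a (inj₂ (out , _)) = out (inj₂ (inj₁ a))

  credible-consistent : ∀ φ → ΦC φ → ConsistentFormula φ
  credible-consistent φ (inj₁ c) =
    let ((ω , chosen) , f⊆) = f-C ‖ φ ‖ c in satisfiable-consistent V φ (ω , f⊆ ω chosen)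
  credible-consistent φ (inj₂ (_ , sat)) = satisfiable-consistent Assignments φ sat

  credible-equiv : ClosedUnderEquiv ΦC
  credible-equiv φ ψ taut (inj₁ c) = inj₁ (𝓔C-resp _ _ (equivalent-extension φ ψ taut) c)
  credible-equiv φ ψ taut (inj₂ (out , (v , φ-true))) =
    inj₂ ( out ∘ 𝓔-resp _ _ (≐-sym (equivalent-extension φ ψ taut))
         , v , proj₁ (equivalent-extension {V = Assignments} φ ψ taut) v φ-true)

  partition : CredibilityPartition ΦC ΦA ΦR
  partition = record
    { cover     = cover
    ; disjCA    = disjCA
    ; disjCR    = disjCR
    ; disjAR    = disjAR
    ; C-taut    = λ φ taut → inj₁ (𝓔C-resp Full ‖ φ ‖ ((λ ω _ → tautology-holds φ taut ω) , _) Ω∈𝓔C)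
    ; C-cons    = credible-consistent
    ; C-equiv   = credible-equiv
    ; A-cons    = λ φ a → let (ω , _ , φ-holds) = f-A ‖ φ ‖ a in satisfiable-consistent V φ (ω , φ-holds)
    ; A-equiv   = λ φ ψ taut → 𝓔A-resp _ _ (equivalent-extension φ ψ taut)
    ; R-contra  = λ φ contra → inj₁ (𝓔R-resp Empty ‖ φ ‖ ((λ _ ()) , contradiction-empty φ contra) ∅∈𝓔R)
    }

  model : Model 𝒞
  model = record
    { ΦC = ΦC ; ΦA = ΦA ; ΦR = ΦR
    ; partition = partition
    ; V = V
    ; compatC = λ _ → inj₁
    ; compatA = λ _ → id
    ; compatR = λ _ → inj₁
    }

module AGM⇒ConditionB (lem : ExcludedMiddle 0ℓ) {Ω : Set} (𝒞 : GCS Ω)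
                      (hA : BasicAGMConsistent 𝒞) (E : Subset Ω) (E∈𝓔 : GCS.𝓔 𝒞 E) where
  open GCS 𝒞
  open Classical lem
  open ≐-Reasoning

  probe : Valuation Ω
  probe 0 = E
  probe 1 = f Full
  probe 2 = f E
  probe 3 = E ∩ f Full
  probe _ = E

  M : Model 𝒞
  M = CanonicalModel.model lem 𝒞 probe
  open Model M using (K; ΦC; ΦA; ΦR)

  p₀ : Formula
  p₀ = atom 0

  B° : Formula → FSet
  B° = proj₁ (hA M)

  B°-agrees : B° p₀ ≐ Th probe (f E)
  B°-agrees = proj₁ (proj₂ (hA M)) p₀ E∈𝓔

  B* : Formula → FSet
  B* = proj₁ (proj₂ (proj₂ (hA M)))

  B*-AGM : IsBasicAGM K B*
  B*-AGM = proj₁ (proj₂ (proj₂ (proj₂ (hA M))))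
  open IsBasicAGM B*-AGM

  B°-by-class : (ΦR p₀ → B° p₀ ≐ K) × (ΦC p₀ → B° p₀ ≐ B* p₀) × (ΦA p₀ → B° p₀ ≐ (K ∩ B* p₀))
  B°-by-class = proj₂ (proj₂ (proj₂ (proj₂ (hA M)))) p₀

  -- If E meets f Ω, revising by p₀ is expanding by p₀, i.e. B*(p₀) = Th (E ∩ f Ω).
  compatible-revision : Inhabited (E ∩ f Full) → B* p₀ ≐ Th probe (E ∩ f Full)
  compatible-revision (ω , e , prior) =
      (λ ψ → proj₁ (expansion (f Full) p₀) ψ ∘ inclusion p₀ ψ)
    , (λ ψ → vacuity p₀ (λ K∋¬p₀ → K∋¬p₀ ω prior e) ψ ∘ proj₂ (expansion (f Full) p₀) ψ)

  credible : Inhabited (E ∩ f Full) → 𝓔C E → f E ≐ (E ∩ f Full)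
  credible meets c = atom-sets-determined 2 3 (begin
    Th probe (f E)          ≈⟨ B°-agrees ⟨
    B° p₀                   ≈⟨ proj₁ (proj₂ B°-by-class) (inj₁ c) ⟩
    B* p₀                   ≈⟨ compatible-revision meets ⟩
    Th probe (E ∩ f Full)   ∎)

  arguable-compatible : Inhabited (E ∩ f Full) → 𝓔A E → f E ≐ f Full
  arguable-compatible meets a = atom-sets-determined 2 1 (begin
    Th probe (f E)                    ≈⟨ B°-agrees ⟨
    B° p₀                             ≈⟨ proj₂ (proj₂ B°-by-class) a ⟩
    K ∩ B* p₀                         ≈⟨ ∩-cong ≐-refl (compatible-revision meets) ⟩
    K ∩ Th probe (E ∩ f Full)         ≈⟨ ∩-absorb (Th-antitone (λ _ → proj₂)) ⟩
    K                                 ∎)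

  -- For E ∈ 𝓔A in general, f E = f Ω ∪ (f E ∩ E): the atom naming f E lies in K,
  -- and p₁ ∨ p₀ lies both in K and in B*(p₀) ∋ p₀.
  arguable : 𝓔A E → f E ≐ (f Full ∪ (f E ∩ E))
  arguable a = split-by prior⊆chosen chosen⊆prior∪E
    where
    Th-fE≐ : Th probe (f E) ≐ (K ∩ B* p₀)
    Th-fE≐ = ≐-trans (≐-sym B°-agrees) (proj₂ (proj₂ B°-by-class) a)
    prior⊆chosen : f Full ⊆ f E
    prior⊆chosen = proj₁ (proj₁ Th-fE≐ (atom 2) (λ _ → id))
    q : Formula
    q = atom 1 ∨′ p₀
    q∈B* : B* p₀ q
    q∈B* = proj₂ (closure p₀) q (Cn-intro q (p₀ ∷ []) (success p₀ ∷ [])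
             (λ v → λ { (p₀-true ∷ []) → from (∨-true (v 1) (v 0)) (inj₂ p₀-true) }))
    chosen⊆prior∪E : f E ⊆ (f Full ∪ E)
    chosen⊆prior∪E = proj₂ Th-fE≐ q ((λ _ → inj₁) , q∈B*)

AGM⇒conditionB : ExcludedMiddle 0ℓ → {Ω : Set} (𝒞 : GCS Ω) → BasicAGMConsistent 𝒞 → ConditionB 𝒞
AGM⇒conditionB lem 𝒞 hA E E∈𝓔 =
    (λ meets → credible meets , arguable-compatible meets)
  , (λ _ a → (f E ∩ E) , (λ _ → proj₂) , f-A E a , arguable a)
  where
  open GCS 𝒞 using (f; f-A)
  open AGM⇒ConditionB lem 𝒞 hA E E∈𝓔

module ConditionB-facts (lem : ExcludedMiddle 0ℓ) {Ω : Set} (𝒞 : GCS Ω) (hB : ConditionB 𝒞) where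
  open GCS 𝒞
  open ≐-Reasoning

  Plausible : Subset Ω → Set
  Plausible E = 𝓔C E ⊎ 𝓔A E

  Plausible-resp : {E E′ : Subset Ω} → E ≐ E′ → Plausible E → Plausible E′
  Plausible-resp E≐E′ (inj₁ c) = inj₁ (𝓔C-resp _ _ E≐E′ c)
  Plausible-resp E≐E′ (inj₂ a) = inj₂ (𝓔A-resp _ _ E≐E′ a)

  plausible-meets : {E : Subset Ω} → Plausible E → Inhabited (f E ∩ E)
  plausible-meets {E} (inj₁ c) = let ((ω , chosen) , f⊆) = f-C E c in ω , chosen , f⊆ ω chosen
  plausible-meets {E} (inj₂ a) = f-A E a

  plausible-compatible : {E : Subset Ω} → Plausible E → Inhabited (E ∩ f Full)
    → (f E ∩ E) ≐ (E ∩ f Full)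
  plausible-compatible {E} (inj₁ c) meets = begin
    f E ∩ E       ≈⟨ ∩-absorb (proj₂ (f-C E c)) ⟩
    f E           ≈⟨ proj₁ (proj₁ (hB E (inj₁ c)) meets) c ⟩
    E ∩ f Full    ∎
  plausible-compatible {E} (inj₂ a) meets = begin
    f E ∩ E       ≈⟨ ∩-cong (proj₂ (proj₁ (hB E (inj₂ (inj₁ a))) meets) a) ≐-refl ⟩
    f Full ∩ E    ≈⟨ ∩-comm ⟩
    E ∩ f Full    ∎

  -- Every E ∈ 𝓔A satisfies f E = f Ω ∪ (f E ∩ E), by (B1b) or (B2).
  arguable-split : {E : Subset Ω} → 𝓔A E → f E ≐ (f Full ∪ (f E ∩ E))
  arguable-split {E} a with lem {Inhabited (E ∩ f Full)}
  ... | yes meets = split-by (proj₂ fE≐fΩ) (λ ω → inj₁ ∘ proj₁ fE≐fΩ ω)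
    where
    fE≐fΩ : f E ≐ f Full
    fE≐fΩ = proj₂ (proj₁ (hB E (inj₂ (inj₁ a))) meets) a
  ... | no misses =
    let (E′ , E′⊆E , _ , fE≐fΩ∪E′) = proj₂ (hB E (inj₂ (inj₁ a))) (λ ω x → misses (ω , x)) a
    in split-by (λ ω → proj₂ fE≐fΩ∪E′ ω ∘ inj₁) (λ ω → map₂ (E′⊆E ω) ∘ proj₁ fE≐fΩ∪E′ ω)

module ConditionB⇒AGM (lem : ExcludedMiddle 0ℓ) {Ω : Set} (𝒞 : GCS Ω)
                      (hB : ConditionB 𝒞) (M : Model 𝒞) where
  open GCS 𝒞
  open Model M
  open Classical lem
  open ConditionB-facts lem 𝒞 hB
  open ≐-Reasoning
  module P = CredibilityPartition partition

  ‖_‖ : Formula → Subset Ω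
  ‖ φ ‖ = ⟦ φ ⟧ V

  Compatible : Formula → Set
  Compatible φ = Inhabited (‖ φ ‖ ∩ f Full)

  -- The revision function, defined by cases.  It is kept abstract: the rest
  -- of the proof uses only the three equations below.
  abstract
    revise : (φ : Formula) → Dec (Plausible ‖ φ ‖) → Dec (Compatible φ) → FSet
    revise φ (yes _) _       = Th V (f ‖ φ ‖ ∩ ‖ φ ‖)
    revise φ (no _)  (yes _) = Th V (‖ φ ‖ ∩ f Full)
    revise φ (no _)  (no _)  = Th Assignments (⟦ φ ⟧ Assignments)

    B* : Formula → FSet
    B* φ = revise φ lem lem

    B*-plausible : ∀ {φ} → Plausible ‖ φ ‖ → B* φ ≐ Th V (f ‖ φ ‖ ∩ ‖ φ ‖)
    B*-plausible {φ} p = unfold lem lem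
      where
      unfold : ∀ d₁ d₂ → revise φ d₁ d₂ ≐ Th V (f ‖ φ ‖ ∩ ‖ φ ‖)
      unfold (yes _) _ = ≐-refl
      unfold (no ¬p) _ = ⊥-elim (¬p p)

    -- By (B1) the first two cases agree whenever both apply.
    B*-compatible : ∀ {φ} → Compatible φ → B* φ ≐ Th V (‖ φ ‖ ∩ f Full)
    B*-compatible {φ} c = unfold lem lem
      where
      unfold : ∀ d₁ d₂ → revise φ d₁ d₂ ≐ Th V (‖ φ ‖ ∩ f Full)
      unfold (yes p) _      = Th-resp (plausible-compatible p c)
      unfold (no _) (yes _) = ≐-refl
      unfold (no _) (no ¬c) = ⊥-elim (¬c c)

    B*-otherwise : ∀ {φ} → ¬ Plausible ‖ φ ‖ → ¬ Compatible φ
      → B* φ ≐ Th Assignments (⟦ φ ⟧ Assignments)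
    B*-otherwise {φ} ¬p ¬c = unfold lem lem
      where
      unfold : ∀ d₁ d₂ → revise φ d₁ d₂ ≐ Th Assignments (⟦ φ ⟧ Assignments)
      unfold (yes p) _      = ⊥-elim (¬p p)
      unfold (no _) (yes c) = ⊥-elim (¬c c)
      unfold (no _) (no _)  = ≐-refl

  B*-theory : ∀ φ → TheoryOfStates (B* φ) φ
  B*-theory φ with lem {Compatible φ} | lem {Plausible ‖ φ ‖}
  ... | yes (ω , meets) | _ = record
    { U = V ; R = ‖ φ ‖ ∩ f Full ; R⊨φ = λ _ → proj₁
    ; nonempty = λ empty → ⊥-elim (empty ω meets) ; B≐Th = B*-compatible (ω , meets) }
  ... | no _  | yes p = record
    { U = V ; R = f ‖ φ ‖ ∩ ‖ φ ‖ ; R⊨φ = λ _ → proj₂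
    ; nonempty = λ empty → ⊥-elim (empty _ (proj₂ (plausible-meets p))) ; B≐Th = B*-plausible p }
  ... | no ¬c | no ¬p = record
    { U = Assignments ; R = ⟦ φ ⟧ Assignments ; R⊨φ = λ _ → id
    ; nonempty = contradiction-if-unsatisfiable φ ; B≐Th = B*-otherwise ¬p ¬c }

  -- For compatible φ, B*(φ) is the expansion K + φ; otherwise K + φ = Φ.
  B*-inclusion : ∀ φ → B* φ ⊆ Cn (K +′ φ)
  B*-inclusion φ ψ with lem {Compatible φ}
  ... | yes c = proj₂ (expansion (f Full) φ) ψ ∘ proj₁ (B*-compatible c) ψ
  ... | no ¬c = λ _ → proj₂ (expansion (f Full) φ) ψ (λ ω x → ⊥-elim (¬c (ω , x)))

  B*-vacuity : ∀ φ → ¬ K (¬′ φ) → Cn (K +′ φ) ⊆ B* φ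
  B*-vacuity φ K∌¬φ ψ with lem {Compatible φ}
  ... | yes c = proj₂ (B*-compatible c) ψ ∘ proj₁ (expansion (f Full) φ) ψ
  ... | no ¬c = ⊥-elim (K∌¬φ (λ ω prior φ-holds → ¬c (ω , φ-holds , prior)))

  -- Every case of the definition depends on ‖φ‖ and the Boolean models of φ only.
  B*-extensional : ∀ φ ψ → Tautology (φ ⇔′ ψ) → B* φ ≐ B* ψ
  B*-extensional φ ψ taut = by-cases (equivalent-extension φ ψ taut) lem lem
    where
    by-cases : ‖ φ ‖ ≐ ‖ ψ ‖ → Dec (Compatible φ) → Dec (Plausible ‖ φ ‖) → B* φ ≐ B* ψ
    by-cases same (yes c) _ = begin
      B* φ                   ≈⟨ B*-compatible c ⟩
      Th V (‖ φ ‖ ∩ f Full)  ≈⟨ Th-resp (∩-cong same ≐-refl) ⟩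
      Th V (‖ ψ ‖ ∩ f Full)  ≈⟨ B*-compatible (meets-resp same c) ⟨
      B* ψ                   ∎
    by-cases same (no _) (yes p) = begin
      B* φ                     ≈⟨ B*-plausible p ⟩
      Th V (f ‖ φ ‖ ∩ ‖ φ ‖)   ≈⟨ Th-resp (∩-cong (f-resp _ _ same) same) ⟩
      Th V (f ‖ ψ ‖ ∩ ‖ ψ ‖)   ≈⟨ B*-plausible (Plausible-resp same p) ⟨
      B* ψ                     ∎
    by-cases same (no ¬c) (no ¬p) = begin
      B* φ                                ≈⟨ B*-otherwise ¬p ¬c ⟩
      Th Assignments (⟦ φ ⟧ Assignments)  ≈⟨ Th-resp (equivalent-extension φ ψ taut) ⟩
      Th Assignments (⟦ ψ ⟧ Assignments)  ≈⟨ B*-otherwise ¬p′ ¬c′ ⟨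
      B* ψ                                ∎
      where
      ¬p′ : ¬ Plausible ‖ ψ ‖
      ¬p′ = ¬p ∘ Plausible-resp (≐-sym same)
      ¬c′ : ¬ Compatible ψ
      ¬c′ = ¬c ∘ meets-resp (≐-sym same)

  B*-AGM : IsBasicAGM K B*
  B*-AGM = record
    { closure        = theory-closed ∘ B*-theory
    ; success        = theory-success ∘ B*-theory
    ; inclusion      = B*-inclusion
    ; vacuity        = B*-vacuity
    ; consistency    = theory-consistency ∘ B*-theory
    ; extensionality = B*-extensional
    }

  -- B°(φ) is the belief set prescribed for the credibility class of φ;
  -- as the classes partition Φ, exactly one prescription applies.
  B° : Formula → FSet
  B° φ ψ = (ΦC φ → B* φ ψ) × (ΦA φ → (K ∩ B* φ) ψ) × (ΦR φ → K ψ)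

  B°-C : ∀ {φ} → ΦC φ → B° φ ≐ B* φ
  B°-C {φ} c = (λ _ b → proj₁ b c)
             , (λ _ b → (λ _ → b) , (λ a → ⊥-elim (P.disjCA φ c a)) , (λ r → ⊥-elim (P.disjCR φ c r)))

  B°-A : ∀ {φ} → ΦA φ → B° φ ≐ (K ∩ B* φ)
  B°-A {φ} a = (λ _ b → proj₁ (proj₂ b) a)
             , (λ _ b → (λ c → ⊥-elim (P.disjCA φ c a)) , (λ _ → b) , (λ r → ⊥-elim (P.disjAR φ a r)))

  B°-R : ∀ {φ} → ΦR φ → B° φ ≐ K
  B°-R {φ} r = (λ _ b → proj₂ (proj₂ b) r)
             , (λ _ k → (λ c → ⊥-elim (P.disjCR φ c r)) , (λ a → ⊥-elim (P.disjAR φ a r)) , (λ _ → k))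

  B°-agrees : ∀ φ → Ψ φ → B° φ ≐ BKΨ φ
  B°-agrees φ (inj₁ c) = begin
    B° φ                    ≈⟨ B°-C (compatC φ c) ⟩
    B* φ                    ≈⟨ B*-plausible (inj₁ c) ⟩
    Th V (f ‖ φ ‖ ∩ ‖ φ ‖)  ≈⟨ Th-resp (∩-absorb (proj₂ (f-C _ c))) ⟩
    Th V (f ‖ φ ‖)          ∎
  B°-agrees φ (inj₂ (inj₁ a)) = begin
    B° φ                                   ≈⟨ B°-A (compatA φ a) ⟩
    K ∩ B* φ                               ≈⟨ ∩-cong ≐-refl (B*-plausible (inj₂ a)) ⟩
    Th V (f Full) ∩ Th V (f ‖ φ ‖ ∩ ‖ φ ‖)  ≈⟨ Th-∪ ⟩
    Th V (f Full ∪ (f ‖ φ ‖ ∩ ‖ φ ‖))       ≈⟨ Th-resp (arguable-split a) ⟨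
    Th V (f ‖ φ ‖)                         ∎
  B°-agrees φ (inj₂ (inj₂ r)) = begin
    B° φ            ≈⟨ B°-R (compatR φ r) ⟩
    Th V (f Full)   ≈⟨ Th-resp (f-R _ r) ⟨
    Th V (f ‖ φ ‖)  ∎

conditionB⇒AGM : ExcludedMiddle 0ℓ → {Ω : Set} (𝒞 : GCS Ω) → ConditionB 𝒞 → BasicAGMConsistent 𝒞
conditionB⇒AGM lem 𝒞 hB M = B° , B°-agrees , B* , B*-AGM , λ _ → B°-R , B°-C , B°-A
  where open ConditionB⇒AGM lem 𝒞 hB M

proposition2 : ExcludedMiddle (Level.suc 0ℓ) → (Ω : Set) → (𝒞 : GCS Ω)
    → BasicAGMConsistent 𝒞 ⇔ ConditionB 𝒞
proposition2 em Ω 𝒞 = mk⇔ (AGM⇒conditionB lem 𝒞) (conditionB⇒AGM lem 𝒞)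
  where
  lem : ExcludedMiddle 0ℓ
  lem {P} = map′ lower lift (em {Level.Lift (Level.suc 0ℓ) P})
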